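{- Let $\mathcal{L}$, $\mathcal{C}$, $\mathcal{M}$, the types $\sigma_C,\rho_C$ ($C\in\mathcal{C}$), $\sigma_M,\rho^1_M,\rho^2_M$ and label sets $L_M$ ($M\in\mathcal{M}$), and the repository $\Delta^{\mathcal{C},\mathcal{M}}_{\mathcal{L}}$ be as in the context. Let $M_1,\ldots,M_n\in\mathcal{M}$, let $C\in\mathcal{C}$, let $\sigma\in\mathbb{T}$ and $\rho\in\mathbb{T}_R$ be types such that $[\![\sigma\to\rho]\!]$ is defined, and let $k\in\mathbb{N}$. If $\Delta^{\mathcal{C},\mathcal{M}}_{\mathcal{L}}\vdash_k C\triangleright M_1\triangleright\cdots\triangleright M_n : [\![\sigma\to\rho]\!]$ in $\mathsf{BCL}_k(\mathbb{T}_C)$, then $\vdash C\triangleright M_1\triangleright\cdots\triangleright M_n:\sigma\to\rho$ holds in the type assignment system for $\Lambda_R$ (with empty basis).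
   Context: Notation: $x\triangleright f$ denotes $f\,x$, left associative, so $C\triangleright M_1\triangleright\cdots\triangleright M_n$ denotes $M_n(\cdots(M_1\,C)\cdots)$ (read both as a $\Lambda_R$ term and as a combinatory term). $\Lambda_R$ terms: $M,N::=x\mid \lambda x.M\mid MN\mid M.l\mid R\mid M\oplus R$, records $R::=\langle l_i=M_i\mid i\in I\rangle$ ($I$ finite, labels distinct); $\mathrm{lbl}(\langle l_i=M_i\mid i\in I\rangle)=\{l_i\mid i\in I\}$. $\mathbf{Y}=\lambda f.(\lambda x.f(xx))(\lambda x.f(xx))$. Types $\mathbb{T}$: $\sigma::=a\mid\omega\mid\sigma\to\sigma\mid\sigma\cap\sigma\mid\rho$; record types $\mathbb{T}_R$: $\rho::=\langle\rangle\mid\langle l:\sigma\rangle\mid\rho+\rho\mid\rho\cap\rho$ ($a$ type constants, $l$ labels). Subtyping $\le$ is the least preorder with: $\sigma\le\omega$; $\omega\le\omega\to\omega$; $\sigma\cap\tau\le\sigma$; $\sigma\cap\tau\le\tau$; $\sigma\le\tau_1,\sigma\le\tau_2\Rightarrow\sigma\le\tau_1\cap\tau_2$; $(\sigma\to\tau_1)\cap(\sigma\to\tau_2)\le\sigma\to\tau_1\cap\tau_2$; $\sigma_2\le\sigma_1,\tau_1\le\tau_2\Rightarrow\sigma_1\to\tau_1\le\sigma_2\to\tau_2$; $\langle l:\sigma\rangle\le\langle\rangle$; $\langle l:\sigma\rangle\cap\langle l:\tau\rangle\le\langle l:\sigma\cap\tau\rangle$; $\sigma\le\tau\Rightarrow\langle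 l:\sigma\rangle\le\langle l:\tau\rangle$; and, writing $\sigma=\tau$ for $\sigma\le\tau\wedge\tau\le\sigma$: $\rho+\langle\rangle=\langle\rangle+\rho=\rho$; $(\rho_1+\rho_2)+\rho_3=\rho_1+(\rho_2+\rho_3)$; $(\rho_1\cap\rho_2)+\rho_3=(\rho_1+\rho_3)\cap(\rho_2+\rho_3)$; $\langle l:\sigma\rangle+(\langle l:\tau\rangle\cap\rho)=\langle l:\tau\rangle\cap\rho$; $\langle l:\sigma\rangle+(\langle l':\tau\rangle\cap\rho)=\langle l':\tau\rangle\cap(\langle l:\sigma\rangle+\rho)$ if $l\ne l'$; $\rho_1\le\rho_2\Rightarrow\rho_1+\rho\le\rho_2+\rho$; $\rho_1=\rho_2\Rightarrow\rho+\rho_1=\rho+\rho_2$. For record types, $\mathrm{lbl}(\langle\rangle)=\emptyset$, $\mathrm{lbl}(\langle l:\sigma\rangle)=\{l\}$, $\mathrm{lbl}(\rho_1\cap\rho_2)=\mathrm{lbl}(\rho_1+\rho_2)=\mathrm{lbl}(\rho_1)\cup\mathrm{lbl}(\rho_2)$. Type assignment for $\Lambda_R$ (bases $\Gamma$ are finite sets $x_1:\sigma_1,\dots$ with distinct variables): $x:\sigma\in\Gamma\Rightarrow\Gamma\vdash x:\sigma$; from $\Gamma,x:\sigma\vdash M:\tau$ infer $\Gamma\vdash\lambda x.M:\sigma\to\tau$; from $\Gamma\vdash M:\sigma\to\tau$ and $\Gamma\vdash N:\sigma$ infer $\Gamma\vdash MN:\tau$; from $\Gamma\vdash M:\sigma$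 and $\Gamma\vdash M:\tau$ infer $\Gamma\vdash M:\sigma\cap\tau$; $\Gamma\vdash M:\omega$; from $\Gamma\vdash M:\sigma$ and $\sigma\le\tau$ infer $\Gamma\vdash M:\tau$; $\Gamma\vdash\langle l_i=M_i\mid i\in I\rangle:\langle\rangle$; from $\Gamma\vdash M_k:\sigma$, $k\in I$ infer $\Gamma\vdash\langle l_i=M_i\mid i\in I\rangle:\langle l_k:\sigma\rangle$; from $\Gamma\vdash M:\langle l:\sigma\rangle$ infer $\Gamma\vdash M.l:\sigma$; from $\Gamma\vdash M:\rho_1$, $\Gamma\vdash R:\rho_2$ and $\mathrm{lbl}(R)=\mathrm{lbl}(\rho_2)$ infer $\Gamma\vdash M\oplus R:\rho_1+\rho_2$. $\mathsf{BCL}_k(\mathbb{T}_C)$: types $\mathbb{T}_C$: $\tau::=a\mid\alpha\mid\omega\mid\tau\to\tau\mid\tau\cap\tau\mid c(\tau)$ ($\alpha$ type variables, $c$ unary constructors). Subtyping on $\mathbb{T}_C$: the arrow/intersection/$\omega$ axioms above plus $\tau_1\le\tau_2\Rightarrow c(\tau_1)\le c(\tau_2)$ and $c(\tau_1)\cap c(\tau_2)\le c(\tau_1\cap\tau_2)$. Level: $\mathrm{level}(\omega)=\mathrm{level}(a)=\mathrm{level}(\alpha)=0$, $\mathrm{level}(c(\tau))=1+\mathrm{level}(\tau)$, $\mathrm{level}(\sigma\to\tau)=1+\max(\mathrm{level}(\sigma),\mathrm{level}(\tau))$, $\mathrm{level}(\sigma\cap\tau)=\max(\mathrm{level}(\sigma),\mathrm{level}(\tau))$;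 a substitution $S$ maps type variables to types (extended homomorphically), $\mathrm{level}(S)=\max\{\mathrm{level}(S(\alpha))\mid\alpha\in\mathrm{dom}(S)\}$. A repository $\Delta$ is a finite set of typed combinator names $C:\tau$; combinatory terms $E::=C\mid(E\,E')$. Rules: $C:\tau\in\Delta$, $\mathrm{level}(S)\le k$ $\Rightarrow\Delta\vdash_k C:S(\tau)$; $\to$-elimination; $\cap$-introduction; subsumption along $\le$. Translation: fix a finite label set $\mathcal{L}$ and unary constructors $\mathrm{rec}(\cdot)$ and $l(\cdot)$ for $l\in\mathcal{L}$. The partial map $[\![\cdot]\!]:\mathbb{T}\to\mathbb{T}_C$: $[\![\omega]\!]=\omega$, $[\![a]\!]=a$, $[\![\sigma\to\tau]\!]=[\![\sigma]\!]\to[\![\tau]\!]$, $[\![\sigma\cap\tau]\!]=[\![\sigma]\!]\cap[\![\tau]\!]$, $[\![\langle l:\tau\rangle]\!]=\mathrm{rec}(l([\![\tau]\!]))$ for $l\in\mathcal{L}$, $[\![\langle\rangle]\!]=\mathrm{rec}(\omega)$; it is undefined otherwise (in particular on types containing $+$). Setting: $\mathcal{C}$ is a finite set of classes, i.e. closed terms $\mathbf{Y}(\lambda\mathit{myClass}.\lambda\mathit{state}.\langle l_i=N_i\mid i\in I\rangle)$, each $C\in\mathcal{C}$ with types $\sigma_C\in\mathbb{T}$, $\rho_C\in\mathbb{T}_R$ such that $[\![\sigma_C\to\rho_C]\!]$ is defined and $\vdash C:\sigma_C\to\rho_C$. $\mathcal{M}$ is a finite set of mixins, i.e. closed terms $M\equiv\lambda\mathit{argClass}.\mathbf{Y}(\lambda\mathit{myClass}.\lambda\mathit{state}.(\mathit{argClass}\;\mathit{state})\oplus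 R_M)$ with $R_M$ a record, each with types $\sigma_M\in\mathbb{T}$, $\rho^1_M,\rho^2_M\in\mathbb{T}_R$ such that $[\![\sigma_M]\!],[\![\rho^1_M]\!],[\![\rho^2_M]\!]$ are defined and for all $\rho\in\mathbb{T}_R$: $\vdash M:(\sigma_M\to\rho\cap\rho^1_M)\to(\sigma_M\to\rho+\rho^2_M)$; $L_M=\mathrm{lbl}(\rho^2_M)=\mathrm{lbl}(R_M)\subseteq\mathcal{L}$ is non-empty. The repository is $\Delta^{\mathcal{C},\mathcal{M}}_{\mathcal{L}}=\{C:[\![\sigma_C\to\rho_C]\!]\mid C\in\mathcal{C}\}\cup\{M:((\,[\![\sigma_M]\!]\to[\![\rho^1_M]\!])\to([\![\sigma_M]\!]\to[\![\rho^2_M]\!]))\cap\bigcap_{l\in\mathcal{L}\setminus L_M}((\,[\![\sigma_M]\!]\to\mathrm{rec}(l(\alpha_l)))\to([\![\sigma_M]\!]\to\mathrm{rec}(l(\alpha_l))))\mid M\in\mathcal{M}\}$, with distinct type variables $\alpha_l$. -}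

module Defs where

open import Data.Nat using (ℕ; _≤_; _⊔_; suc; zero)
open import Data.Nat.Properties using (_≟_)
open import Data.List using (List; []; _∷_; _++_; map; filter; foldr)
open import Data.List.Relation.Unary.All using (All)
open import Data.List.Relation.Unary.Unique.Propositional using (Unique)
open import Data.List.Membership.Propositional using (_∈_)
open import Data.List.Membership.DecPropositional _≟_ using (_∈?_)
open import Data.Maybe using (Maybe; just; nothing)
open import Data.Product using (_×_; _,_; proj₁; proj₂)
open import Relation.Nullary using (¬_; yes; no)
open import Relation.Nullary.Decidable using (¬?)
open import Relation.Binary.PropositionalEquality using (_≡_; _≢_)
open import Function.Bundles using (_⇔_)

Label : Set
Label = ℕ

Var : Set
Var = ℕ

data Term : Set where
  var  : Var → Term
  lam  : Var → Term → Term
  app  : Term → Term → Term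
  sel  : Term → Label → Term
  recd : List (Label × Term) → Term
  _⊕_  : Term → List (Label × Term) → Term

lblR : List (Label × Term) → List Label
lblR = map proj₁

data WF : Term → Set where
  wvar : ∀ {x} → WF (var x)
  wlam : ∀ {x M} → WF M → WF (lam x M)
  wapp : ∀ {M N} → WF M → WF N → WF (app M N)
  wsel : ∀ {M l} → WF M → WF (sel M l)
  wrec : ∀ {fs} → Unique (lblR fs) → All (λ p → WF (proj₂ p)) fs → WF (recd fs)
  w⊕   : ∀ {M fs} → WF M → Unique (lblR fs) → All (λ p → WF (proj₂ p)) fs
         → WF (M ⊕ fs)

data Scoped (xs : List Var) : Term → Set where
  svar : ∀ {x} → x ∈ xs → Scoped xs (var x)
  slam : ∀ {x M} → Scoped (x ∷ xs) M → Scoped xs (lam x M)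
  sapp : ∀ {M N} → Scoped xs M → Scoped xs N → Scoped xs (app M N)
  ssel : ∀ {M l} → Scoped xs M → Scoped xs (sel M l)
  srec : ∀ {fs} → All (λ p → Scoped xs (proj₂ p)) fs → Scoped xs (recd fs)
  s⊕   : ∀ {M fs} → Scoped xs M → All (λ p → Scoped xs (proj₂ p)) fs
         → Scoped xs (M ⊕ fs)

Closed : Term → Set
Closed = Scoped []

Y : Term
Y = lam 0 (app (lam 1 (app (var 0) (app (var 1) (var 1))))
               (lam 1 (app (var 0) (app (var 1) (var 1)))))

-- Types 𝕋 (single raw syntax; well-formedness picks out 𝕋 and 𝕋_R)

infixr 7 _⇒_
infixl 8 _∩_
infixl 9 _+ᵣ_

data Ty : Set where
  `_    : ℕ → Ty
  ω     : Ty
  _⇒_   : Ty → Ty → Ty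
  _∩_   : Ty → Ty → Ty
  ⟨⟩    : Ty
  ⟨_∶_⟩ : Label → Ty → Ty
  _+ᵣ_  : Ty → Ty → Ty

mutual
  data IsType : Ty → Set where
    tcon : ∀ {a} → IsType (` a)
    tω   : IsType ω
    t⇒   : ∀ {σ τ} → IsType σ → IsType τ → IsType (σ ⇒ τ)
    t∩   : ∀ {σ τ} → IsType σ → IsType τ → IsType (σ ∩ τ)
    trec : ∀ {ρ} → IsRec ρ → IsType ρ

  data IsRec : Ty → Set where
    r⟨⟩ : IsRec ⟨⟩
    rl  : ∀ {l σ} → IsType σ → IsRec ⟨ l ∶ σ ⟩
    r+  : ∀ {ρ₁ ρ₂} → IsRec ρ₁ → IsRec ρ₂ → IsRec (ρ₁ +ᵣ ρ₂)
    r∩  : ∀ {ρ₁ ρ₂} → IsRec ρ₁ → IsRec ρ₂ → IsRec (ρ₁ ∩ ρ₂)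

lblT : Ty → List Label
lblT ⟨⟩ = []
lblT ⟨ l ∶ σ ⟩ = l ∷ []
lblT (ρ₁ ∩ ρ₂) = lblT ρ₁ ++ lblT ρ₂
lblT (ρ₁ +ᵣ ρ₂) = lblT ρ₁ ++ lblT ρ₂
lblT _ = []

_≈ˡ_ : List Label → List Label → Set
A ≈ˡ B = ∀ l → (l ∈ A) ⇔ (l ∈ B)

data RecAx : Ty → Ty → Set where
  +⟨⟩   : ∀ {ρ} → IsRec ρ → RecAx (ρ +ᵣ ⟨⟩) ρ
  ⟨⟩+   : ∀ {ρ} → IsRec ρ → RecAx (⟨⟩ +ᵣ ρ) ρ
  assoc : ∀ {ρ₁ ρ₂ ρ₃} → IsRec ρ₁ → IsRec ρ₂ → IsRec ρ₃
          → RecAx ((ρ₁ +ᵣ ρ₂) +ᵣ ρ₃) (ρ₁ +ᵣ (ρ₂ +ᵣ ρ₃))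
  ∩+    : ∀ {ρ₁ ρ₂ ρ₃} → IsRec ρ₁ → IsRec ρ₂ → IsRec ρ₃
          → RecAx ((ρ₁ ∩ ρ₂) +ᵣ ρ₃) ((ρ₁ +ᵣ ρ₃) ∩ (ρ₂ +ᵣ ρ₃))
  same  : ∀ {l σ τ ρ} → IsType σ → IsType τ → IsRec ρ
          → RecAx (⟨ l ∶ σ ⟩ +ᵣ (⟨ l ∶ τ ⟩ ∩ ρ)) (⟨ l ∶ τ ⟩ ∩ ρ)
  diff  : ∀ {l l′ σ τ ρ} → l ≢ l′ → IsType σ → IsType τ → IsRec ρ
          → RecAx (⟨ l ∶ σ ⟩ +ᵣ (⟨ l′ ∶ τ ⟩ ∩ ρ)) (⟨ l′ ∶ τ ⟩ ∩ (⟨ l ∶ σ ⟩ +ᵣ ρ))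

infix 4 _≼_

-- subtyping on 𝕋 (only relates well-formed types)
data _≼_ : Ty → Ty → Set where
  ≼-refl  : ∀ {σ} → IsType σ → σ ≼ σ
  ≼-trans : ∀ {σ τ υ} → σ ≼ τ → τ ≼ υ → σ ≼ υ
  ≼ω      : ∀ {σ} → IsType σ → σ ≼ ω
  ω≼ω⇒ω   : ω ≼ ω ⇒ ω
  ∩≼ˡ     : ∀ {σ τ} → IsType σ → IsType τ → σ ∩ τ ≼ σ
  ∩≼ʳ     : ∀ {σ τ} → IsType σ → IsType τ → σ ∩ τ ≼ τ
  ≼∩      : ∀ {σ τ₁ τ₂} → σ ≼ τ₁ → σ ≼ τ₂ → σ ≼ τ₁ ∩ τ₂
  ⇒∩      : ∀ {σ τ₁ τ₂} → IsType σ → IsType τ₁ → IsType τ₂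
            → (σ ⇒ τ₁) ∩ (σ ⇒ τ₂) ≼ σ ⇒ (τ₁ ∩ τ₂)
  ⇒≼      : ∀ {σ₁ σ₂ τ₁ τ₂} → σ₂ ≼ σ₁ → τ₁ ≼ τ₂ → σ₁ ⇒ τ₁ ≼ σ₂ ⇒ τ₂
  l≼⟨⟩    : ∀ {l σ} → IsType σ → ⟨ l ∶ σ ⟩ ≼ ⟨⟩
  l∩      : ∀ {l σ τ} → IsType σ → IsType τ
            → ⟨ l ∶ σ ⟩ ∩ ⟨ l ∶ τ ⟩ ≼ ⟨ l ∶ σ ∩ τ ⟩
  l≼      : ∀ {l σ τ} → σ ≼ τ → ⟨ l ∶ σ ⟩ ≼ ⟨ l ∶ τ ⟩
  ax→     : ∀ {σ τ} → RecAx σ τ → σ ≼ τ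
  ax←     : ∀ {σ τ} → RecAx σ τ → τ ≼ σ
  +cong   : ∀ {ρ₁ ρ₂ ρ} → IsRec ρ₁ → IsRec ρ₂ → IsRec ρ
            → ρ₁ ≼ ρ₂ → ρ₁ +ᵣ ρ ≼ ρ₂ +ᵣ ρ
  cong+   : ∀ {ρ ρ₁ ρ₂} → IsRec ρ → IsRec ρ₁ → IsRec ρ₂
            → ρ₁ ≼ ρ₂ → ρ₂ ≼ ρ₁ → ρ +ᵣ ρ₁ ≼ ρ +ᵣ ρ₂

-- bases: lists of declarations; the most recent declaration of x wins
Basis : Set
Basis = List (Var × Ty)

lookupB : Var → Basis → Maybe Ty
lookupB x [] = nothing
lookupB x ((y , σ) ∷ Γ) with x ≟ y
... | yes _ = just σ
... | no  _ = lookupB x Γ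

infix 3 _⊢_∶_

data _⊢_∶_ (Γ : Basis) : Term → Ty → Set where
  ⊢var  : ∀ {x σ} → lookupB x Γ ≡ just σ → Γ ⊢ var x ∶ σ
  ⊢lam  : ∀ {x M σ τ} → IsType σ → ((x , σ) ∷ Γ) ⊢ M ∶ τ → Γ ⊢ lam x M ∶ σ ⇒ τ
  ⊢app  : ∀ {M N σ τ} → Γ ⊢ M ∶ σ ⇒ τ → Γ ⊢ N ∶ σ → Γ ⊢ app M N ∶ τ
  ⊢∩    : ∀ {M σ τ} → Γ ⊢ M ∶ σ → Γ ⊢ M ∶ τ → Γ ⊢ M ∶ σ ∩ τ
  ⊢ω    : ∀ {M} → Γ ⊢ M ∶ ω
  ⊢sub  : ∀ {M σ τ} → Γ ⊢ M ∶ σ → σ ≼ τ → Γ ⊢ M ∶ τ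
  ⊢⟨⟩   : ∀ {fs} → Γ ⊢ recd fs ∶ ⟨⟩
  ⊢rec  : ∀ {fs l M σ} → (l , M) ∈ fs → Γ ⊢ M ∶ σ → Γ ⊢ recd fs ∶ ⟨ l ∶ σ ⟩
  ⊢sel  : ∀ {M l σ} → Γ ⊢ M ∶ ⟨ l ∶ σ ⟩ → Γ ⊢ sel M l ∶ σ
  ⊢⊕    : ∀ {M fs ρ₁ ρ₂} → IsRec ρ₁ → IsRec ρ₂
          → Γ ⊢ M ∶ ρ₁ → Γ ⊢ recd fs ∶ ρ₂ → lblR fs ≈ˡ lblT ρ₂
          → Γ ⊢ M ⊕ fs ∶ ρ₁ +ᵣ ρ₂

data Con : Set where
  crec : Con
  clab : Label → Con

data TyC : Set where
  con   : ℕ → TyC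
  tvar  : ℕ → TyC
  ωC    : TyC
  _⇒C_  : TyC → TyC → TyC
  _∩C_  : TyC → TyC → TyC
  _⟪_⟫  : Con → TyC → TyC

infix 4 _≼C_

data _≼C_ : TyC → TyC → Set where
  ≼-refl  : ∀ {σ} → σ ≼C σ
  ≼-trans : ∀ {σ τ υ} → σ ≼C τ → τ ≼C υ → σ ≼C υ
  ≼ω      : ∀ {σ} → σ ≼C ωC
  ω≼ω⇒ω   : ωC ≼C (ωC ⇒C ωC)
  ∩≼ˡ     : ∀ {σ τ} → (σ ∩C τ) ≼C σ
  ∩≼ʳ     : ∀ {σ τ} → (σ ∩C τ) ≼C τ
  ≼∩      : ∀ {σ τ₁ τ₂} → σ ≼C τ₁ → σ ≼C τ₂ → σ ≼C (τ₁ ∩C τ₂)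
  ⇒∩      : ∀ {σ τ₁ τ₂} → ((σ ⇒C τ₁) ∩C (σ ⇒C τ₂)) ≼C (σ ⇒C (τ₁ ∩C τ₂))
  ⇒≼      : ∀ {σ₁ σ₂ τ₁ τ₂} → σ₂ ≼C σ₁ → τ₁ ≼C τ₂ → (σ₁ ⇒C τ₁) ≼C (σ₂ ⇒C τ₂)
  c≼      : ∀ {c τ₁ τ₂} → τ₁ ≼C τ₂ → (c ⟪ τ₁ ⟫) ≼C (c ⟪ τ₂ ⟫)
  c∩      : ∀ {c τ₁ τ₂} → ((c ⟪ τ₁ ⟫) ∩C (c ⟪ τ₂ ⟫)) ≼C (c ⟪ τ₁ ∩C τ₂ ⟫)

level : TyC → ℕ
level (con _) = 0
level (tvar _) = 0
level ωC = 0
level (σ ⇒C τ) = suc (level σ ⊔ level τ)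
level (σ ∩C τ) = level σ ⊔ level τ
level (c ⟪ τ ⟫) = suc (level τ)

-- substitutions as total maps (identity outside their domain)
Subst : Set
Subst = ℕ → TyC

applyS : Subst → TyC → TyC
applyS S (con a) = con a
applyS S (tvar α) = S α
applyS S ωC = ωC
applyS S (σ ⇒C τ) = applyS S σ ⇒C applyS S τ
applyS S (σ ∩C τ) = applyS S σ ∩C applyS S τ
applyS S (c ⟪ τ ⟫) = c ⟪ applyS S τ ⟫

LevelS≤ : Subst → ℕ → Set
LevelS≤ S k = ∀ α → level (S α) ≤ k

data CTm (N : Set) : Set where
  name  : N → CTm N
  _·_   : CTm N → CTm N → CTm N

Repo : Set → Set
Repo N = List (N × TyC)

infix 3 _⊢[_]_∶_

data _⊢[_]_∶_ {N : Set} (Δ : Repo N) (k : ℕ) : CTm N → TyC → Set where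
  ⊢ax  : ∀ {c τ} (S : Subst) → (c , τ) ∈ Δ → LevelS≤ S k → Δ ⊢[ k ] name c ∶ applyS S τ
  ⊢app : ∀ {E E′ σ τ} → Δ ⊢[ k ] E ∶ (σ ⇒C τ) → Δ ⊢[ k ] E′ ∶ σ → Δ ⊢[ k ] (E · E′) ∶ τ
  ⊢∩   : ∀ {E σ τ} → Δ ⊢[ k ] E ∶ σ → Δ ⊢[ k ] E ∶ τ → Δ ⊢[ k ] E ∶ (σ ∩C τ)
  ⊢sub : ∀ {E σ τ} → Δ ⊢[ k ] E ∶ σ → σ ≼C τ → Δ ⊢[ k ] E ∶ τ

-- x ▷ f = f x ;  C ▷ M₁ ▷ ⋯ ▷ Mₙ
pipe : ∀ {N} → CTm N → List (CTm N) → CTm N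
pipe e [] = e
pipe e (m ∷ ms) = pipe (m · e) ms

toΛ : CTm Term → Term
toΛ (name M) = M
toΛ (E · E′) = app (toΛ E) (toΛ E′)

map2 : {A B C : Set} → (A → B → C) → Maybe A → Maybe B → Maybe C
map2 f (just a) (just b) = just (f a b)
map2 f _ _ = nothing

mapM : {A B : Set} → (A → B) → Maybe A → Maybe B
mapM f (just a) = just (f a)
mapM f nothing = nothing

⟦_⟧_ : Ty → List Label → Maybe TyC
⟦ ω ⟧ ℒ = just ωC
⟦ ` a ⟧ ℒ = just (con a)
⟦ σ ⇒ τ ⟧ ℒ = map2 _⇒C_ (⟦ σ ⟧ ℒ) (⟦ τ ⟧ ℒ)
⟦ σ ∩ τ ⟧ ℒ = map2 _∩C_ (⟦ σ ⟧ ℒ) (⟦ τ ⟧ ℒ)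
⟦ ⟨ l ∶ τ ⟩ ⟧ ℒ with l ∈? ℒ
... | yes _ = mapM (λ t → crec ⟪ clab l ⟪ t ⟫ ⟫) (⟦ τ ⟧ ℒ)
... | no  _ = nothing
⟦ ⟨⟩ ⟧ ℒ = just (crec ⟪ ωC ⟫)
⟦ _ +ᵣ _ ⟧ ℒ = nothing

record ClassSpec (ℒ : List Label) : Set where
  field
    myClass state : Var
    myClass≢state : myClass ≢ state
    body   : List (Label × Term)
  term : Term
  term = app Y (lam myClass (lam state (recd body)))
  field
    wf     : WF term
    closed : Closed term
    σC ρC  : Ty
    σC-ty  : IsType σC
    ρC-rec : IsRec ρC
    τC     : TyC
    ⟦σ→ρ⟧  : ⟦ σC ⇒ ρC ⟧ ℒ ≡ just τC
    typed  : [] ⊢ term ∶ σC ⇒ ρC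

record MixinSpec (ℒ : List Label) : Set where
  field
    argClass myClass state : Var
    arg≢my    : argClass ≢ myClass
    arg≢state : argClass ≢ state
    my≢state  : myClass ≢ state
    RM : List (Label × Term)
  term : Term
  term = lam argClass (app Y (lam myClass (lam state (app (var argClass) (var state) ⊕ RM))))
  LM : List Label
  LM = lblR RM
  field
    wf     : WF term
    closed : Closed term
    σM ρ¹ ρ² : Ty
    σM-ty  : IsType σM
    ρ¹-rec : IsRec ρ¹
    ρ²-rec : IsRec ρ²
    ⟦σM⟧ ⟦ρ¹⟧ ⟦ρ²⟧ : TyC
    σM-tr  : ⟦ σM ⟧ ℒ ≡ just ⟦σM⟧
    ρ¹-tr  : ⟦ ρ¹ ⟧ ℒ ≡ just ⟦ρ¹⟧
    ρ²-tr  : ⟦ ρ² ⟧ ℒ ≡ just ⟦ρ²⟧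
    typed  : ∀ ρ → IsRec ρ → [] ⊢ term ∶ (σM ⇒ (ρ ∩ ρ¹)) ⇒ (σM ⇒ (ρ +ᵣ ρ²))
    LM≈lblρ² : LM ≈ˡ lblT ρ²
    LM⊆ℒ   : ∀ l → l ∈ LM → l ∈ ℒ
    LM≢[]  : LM ≢ []

open ClassSpec using () renaming (term to classTerm)
open MixinSpec using () renaming (term to mixinTerm)

⋂ : List TyC → TyC
⋂ = foldr _∩C_ ωC

recVar : Label → TyC
recVar l = crec ⟪ clab l ⟪ tvar l ⟫ ⟫

mixinType : ∀ {ℒ} → MixinSpec ℒ → TyC
mixinType {ℒ} m =
  ((σ ⇒C ρ¹) ⇒C (σ ⇒C ρ²))
  ∩C ⋂ (map (λ l → (σ ⇒C recVar l) ⇒C (σ ⇒C recVar l))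
            (filter (λ l → ¬? (l ∈? MixinSpec.LM m)) ℒ))
  where
  σ  = MixinSpec.⟦σM⟧ m
  ρ¹ = MixinSpec.⟦ρ¹⟧ m
  ρ² = MixinSpec.⟦ρ²⟧ m

Δrepo : ∀ ℒ → List (ClassSpec ℒ) → List (MixinSpec ℒ) → Repo Term
Δrepo ℒ 𝒞 ℳ =
  map (λ c → (classTerm c , ClassSpec.τC c)) 𝒞
  ++ map (λ m → (mixinTerm m , mixinType m)) ℳ

-- Read BCL types back into 𝕋 by a map `decode` that sends type variables and bare
-- label constructors to ω and reads rec(l₁(τ₁) ∩ ⋯ ∩ lₙ(τₙ)) as ⟨l₁:τ₁⟩ ∩ ⋯ ∩ ⟨lₙ:τₙ⟩.
-- It is monotone for subtyping and inverts ⟦·⟧ on translated types, which are ground.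
-- Every instance of a repository type decodes to a type of the combinator in Λ_R:
-- for a class this is its given type, for the main component of a mixin the
-- instance ρ := ⟨⟩ of its typing, and for a component rec(l(α)) with l ∉ L_M the
-- mixin passes the field l through, since ⟨l:X⟩ + ρ ≤ ⟨l:X⟩ when ρ types R_M
-- by ω-fields for its own labels, none of which is l.
-- So every BCL derivation, at any level k and for any combinatory term, decodes
-- into a Λ_R derivation.
module Submission where

open import Defs
open import Data.Nat using (ℕ)
open import Data.Nat.Properties using (_≟_)
open import Data.List using (List; []; _∷_; map; foldr)
open import Data.List.Relation.Unary.All as All using (All; []; _∷_)
open import Data.List.Relation.Unary.All.Properties using (all-filter; map⁺)
open import Data.List.Relation.Unary.Unique.Propositional using (Unique)
open import Data.List.Relation.Unary.Any using (here; there)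
open import Data.List.Membership.Propositional using (_∈_)
open import Data.List.Membership.Propositional.Properties using (∈-++⁻; ∈-map⁻)
open import Data.List.Membership.DecPropositional _≟_ using (_∈?_)
open import Data.Maybe using (just; nothing)
open import Data.Product using (_×_; _,_; proj₁)
open import Data.Sum using (_⊎_; inj₁; inj₂)
open import Data.Empty using (⊥-elim)
open import Relation.Nullary using (¬_; yes; no)
open import Relation.Nullary.Decidable using (¬?)
open import Relation.Binary.PropositionalEquality
  using (_≡_; _≢_; refl; sym; trans; cong; cong₂; subst)
open import Function.Bundles using (mk⇔)

mutual
  decode : TyC → Ty
  decode (con a)          = ` a
  decode (tvar _)         = ω
  decode ωC               = ω
  decode (σ ⇒C τ)         = decode σ ⇒ decode τ
  decode (σ ∩C τ)         = decode σ ∩ decode τ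
  decode (crec ⟪ τ ⟫)     = decodeRec τ
  decode (clab _ ⟪ _ ⟫)   = ω

  decodeRec : TyC → Ty
  decodeRec (σ ∩C τ)       = decodeRec σ ∩ decodeRec τ
  decodeRec (clab l ⟪ τ ⟫) = ⟨ l ∶ decode τ ⟩
  decodeRec _              = ⟨⟩

mutual
  decode-isType : ∀ τ → IsType (decode τ)
  decode-isType (con a)        = tcon
  decode-isType (tvar _)       = tω
  decode-isType ωC             = tω
  decode-isType (σ ⇒C τ)       = t⇒ (decode-isType σ) (decode-isType τ)
  decode-isType (σ ∩C τ)       = t∩ (decode-isType σ) (decode-isType τ)
  decode-isType (crec ⟪ τ ⟫)   = trec (decodeRec-isRec τ)
  decode-isType (clab _ ⟪ _ ⟫) = tω

  decodeRec-isRec : ∀ τ → IsRec (decodeRec τ)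
  decodeRec-isRec (con a)        = r⟨⟩
  decodeRec-isRec (tvar _)       = r⟨⟩
  decodeRec-isRec ωC             = r⟨⟩
  decodeRec-isRec (σ ⇒C τ)       = r⟨⟩
  decodeRec-isRec (σ ∩C τ)       = r∩ (decodeRec-isRec σ) (decodeRec-isRec τ)
  decodeRec-isRec (crec ⟪ _ ⟫)   = r⟨⟩
  decodeRec-isRec (clab _ ⟪ τ ⟫) = rl (decode-isType τ)

decodeRec-isType : ∀ τ → IsType (decodeRec τ)
decodeRec-isType τ = trec (decodeRec-isRec τ)

⟨⟩≼⟨⟩ : ⟨⟩ ≼ ⟨⟩
⟨⟩≼⟨⟩ = ≼-refl (trec r⟨⟩)

decodeRec≼⟨⟩ : ∀ τ → decodeRec τ ≼ ⟨⟩
decodeRec≼⟨⟩ (con a)        = ⟨⟩≼⟨⟩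
decodeRec≼⟨⟩ (tvar _)       = ⟨⟩≼⟨⟩
decodeRec≼⟨⟩ ωC             = ⟨⟩≼⟨⟩
decodeRec≼⟨⟩ (σ ⇒C τ)       = ⟨⟩≼⟨⟩
decodeRec≼⟨⟩ (σ ∩C τ)       =
  ≼-trans (∩≼ˡ (decodeRec-isType σ) (decodeRec-isType τ)) (decodeRec≼⟨⟩ σ)
decodeRec≼⟨⟩ (crec ⟪ _ ⟫)   = ⟨⟩≼⟨⟩
decodeRec≼⟨⟩ (clab _ ⟪ τ ⟫) = l≼⟨⟩ (decode-isType τ)

mutual
  decode-mono : ∀ {σ τ} → σ ≼C τ → decode σ ≼ decode τ
  decode-mono (≼-refl {σ})               = ≼-refl (decode-isType σ)
  decode-mono (≼-trans p q)              = ≼-trans (decode-mono p) (decode-mono q)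
  decode-mono (≼ω {σ})                   = ≼ω (decode-isType σ)
  decode-mono ω≼ω⇒ω                      = ω≼ω⇒ω
  decode-mono (∩≼ˡ {σ} {τ})              = ∩≼ˡ (decode-isType σ) (decode-isType τ)
  decode-mono (∩≼ʳ {σ} {τ})              = ∩≼ʳ (decode-isType σ) (decode-isType τ)
  decode-mono (≼∩ p q)                   = ≼∩ (decode-mono p) (decode-mono q)
  decode-mono (⇒∩ {σ} {τ₁} {τ₂})         =
    ⇒∩ (decode-isType σ) (decode-isType τ₁) (decode-isType τ₂)
  decode-mono (⇒≼ p q)                   = ⇒≼ (decode-mono p) (decode-mono q)
  decode-mono (c≼ {crec} p)              = decodeRec-mono p
  decode-mono (c≼ {clab _} p)            = ≼-refl tω
  decode-mono (c∩ {crec} {τ₁} {τ₂})      =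
    ≼-refl (t∩ (decodeRec-isType τ₁) (decodeRec-isType τ₂))
  decode-mono (c∩ {clab _})              = ∩≼ˡ tω tω

  decodeRec-mono : ∀ {σ τ} → σ ≼C τ → decodeRec σ ≼ decodeRec τ
  decodeRec-mono (≼-refl {σ})            = ≼-refl (decodeRec-isType σ)
  decodeRec-mono (≼-trans p q)           = ≼-trans (decodeRec-mono p) (decodeRec-mono q)
  decodeRec-mono (≼ω {σ})                = decodeRec≼⟨⟩ σ
  decodeRec-mono ω≼ω⇒ω                   = ⟨⟩≼⟨⟩
  decodeRec-mono (∩≼ˡ {σ} {τ})           = ∩≼ˡ (decodeRec-isType σ) (decodeRec-isType τ)
  decodeRec-mono (∩≼ʳ {σ} {τ})           = ∩≼ʳ (decodeRec-isType σ) (decodeRec-isType τ)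
  decodeRec-mono (≼∩ p q)                = ≼∩ (decodeRec-mono p) (decodeRec-mono q)
  decodeRec-mono ⇒∩                      = ∩≼ˡ (trec r⟨⟩) (trec r⟨⟩)
  decodeRec-mono (⇒≼ _ _)                = ⟨⟩≼⟨⟩
  decodeRec-mono (c≼ {crec} _)           = ⟨⟩≼⟨⟩
  decodeRec-mono (c≼ {clab _} p)         = l≼ (decode-mono p)
  decodeRec-mono (c∩ {crec})             = ∩≼ˡ (trec r⟨⟩) (trec r⟨⟩)
  decodeRec-mono (c∩ {clab _} {τ₁} {τ₂}) = l∩ (decode-isType τ₁) (decode-isType τ₂)

-- The graph of ⟦·⟧, forgetting the condition that field labels lie in ℒ.
infix 4 _↝_

data _↝_ : Ty → TyC → Set where
  ↝con   : ∀ {a} → ` a ↝ con a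
  ↝ω     : ω ↝ ωC
  ↝⇒     : ∀ {σ τ s t} → σ ↝ s → τ ↝ t → σ ⇒ τ ↝ s ⇒C t
  ↝∩     : ∀ {σ τ s t} → σ ↝ s → τ ↝ t → σ ∩ τ ↝ s ∩C t
  ↝⟨⟩    : ⟨⟩ ↝ crec ⟪ ωC ⟫
  ↝field : ∀ {l τ t} → τ ↝ t → ⟨ l ∶ τ ⟩ ↝ crec ⟪ clab l ⟪ t ⟫ ⟫

⟦⟧⇒↝ : ∀ ℒ σ {t} → ⟦ σ ⟧ ℒ ≡ just t → σ ↝ t
⟦⟧⇒↝ ℒ (` a) refl = ↝con
⟦⟧⇒↝ ℒ ω refl = ↝ω
⟦⟧⇒↝ ℒ (σ ⇒ τ) eq with ⟦ σ ⟧ ℒ in eσ | ⟦ τ ⟧ ℒ in eτ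
... | just _  | just _  with refl ← eq = ↝⇒ (⟦⟧⇒↝ ℒ σ eσ) (⟦⟧⇒↝ ℒ τ eτ)
... | just _  | nothing with () ← eq
... | nothing | _       with () ← eq
⟦⟧⇒↝ ℒ (σ ∩ τ) eq with ⟦ σ ⟧ ℒ in eσ | ⟦ τ ⟧ ℒ in eτ
... | just _  | just _  with refl ← eq = ↝∩ (⟦⟧⇒↝ ℒ σ eσ) (⟦⟧⇒↝ ℒ τ eτ)
... | just _  | nothing with () ← eq
... | nothing | _       with () ← eq
⟦⟧⇒↝ ℒ ⟨⟩ refl = ↝⟨⟩
⟦⟧⇒↝ ℒ ⟨ l ∶ τ ⟩ eq with l ∈? ℒ
... | no _ with () ← eq
... | yes _ with ⟦ τ ⟧ ℒ in eτ
...   | just _  with refl ← eq = ↝field (⟦⟧⇒↝ ℒ τ eτ)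
...   | nothing with () ← eq
⟦⟧⇒↝ ℒ (_ +ᵣ _) ()

↝-decode : ∀ {σ t} → σ ↝ t → decode t ≡ σ
↝-decode ↝con       = refl
↝-decode ↝ω         = refl
↝-decode (↝⇒ p q)   = cong₂ _⇒_ (↝-decode p) (↝-decode q)
↝-decode (↝∩ p q)   = cong₂ _∩_ (↝-decode p) (↝-decode q)
↝-decode ↝⟨⟩        = refl
↝-decode (↝field p) = cong ⟨ _ ∶_⟩ (↝-decode p)

↝-ground : ∀ S {σ t} → σ ↝ t → applyS S t ≡ t
↝-ground S ↝con       = refl
↝-ground S ↝ω         = refl
↝-ground S (↝⇒ p q)   = cong₂ _⇒C_ (↝-ground S p) (↝-ground S q)
↝-ground S (↝∩ p q)   = cong₂ _∩C_ (↝-ground S p) (↝-ground S q)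
↝-ground S ↝⟨⟩        = refl
↝-ground S (↝field p) = cong (λ t → crec ⟪ clab _ ⟪ t ⟫ ⟫) (↝-ground S p)

↝-decode-applyS : ∀ S {σ t} → σ ↝ t → decode (applyS S t) ≡ σ
↝-decode-applyS S p = trans (cong decode (↝-ground S p)) (↝-decode p)

↝-rec≼⟨⟩ : ∀ {ρ t} → IsRec ρ → ρ ↝ t → ρ ≼ ⟨⟩
↝-rec≼⟨⟩ r⟨⟩ ↝⟨⟩ = ⟨⟩≼⟨⟩
↝-rec≼⟨⟩ (rl σ-ty) (↝field _) = l≼⟨⟩ σ-ty
↝-rec≼⟨⟩ (r∩ ρ₁-rec ρ₂-rec) (↝∩ p _) =
  ≼-trans (∩≼ˡ (trec ρ₁-rec) (trec ρ₂-rec)) (↝-rec≼⟨⟩ ρ₁-rec p)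

⊢-decode-⋂ : ∀ {Γ M} S {ts} → All (λ t → Γ ⊢ M ∶ decode (applyS S t)) ts
             → Γ ⊢ M ∶ decode (applyS S (⋂ ts))
⊢-decode-⋂ S []       = ⊢ω
⊢-decode-⋂ S (d ∷ ds) = ⊢∩ d (⊢-decode-⋂ S ds)

lookupB-here : ∀ x σ Γ → lookupB x ((x , σ) ∷ Γ) ≡ just σ
lookupB-here x σ Γ with x ≟ x
... | yes _ = refl
... | no x≢x = ⊥-elim (x≢x refl)

lookupB-there : ∀ {x y} σ Γ → x ≢ y → lookupB x ((y , σ) ∷ Γ) ≡ lookupB x Γ
lookupB-there {x} {y} σ Γ x≢y with x ≟ y
... | yes x≡y = ⊥-elim (x≢y x≡y)
... | no _ = refl

-- The self-application x x is only given type ω.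
⊢Y : ∀ {Γ T} → IsType T → Γ ⊢ Y ∶ (ω ⇒ T) ⇒ T
⊢Y T-ty =
  ⊢lam (t⇒ tω T-ty)
    (⊢app (⊢lam tω (⊢app (⊢var refl) ⊢ω)) ⊢ω)

ωFields : List (Label × Term) → Ty
ωFields = foldr (λ f ρ → ⟨ proj₁ f ∶ ω ⟩ ∩ ρ) ⟨⟩

ωFields-isRec : ∀ fs → IsRec (ωFields fs)
ωFields-isRec []       = r⟨⟩
ωFields-isRec (_ ∷ fs) = r∩ (rl tω) (ωFields-isRec fs)

lblT-ωFields : ∀ fs → lblT (ωFields fs) ≡ lblR fs
lblT-ωFields []       = refl
lblT-ωFields (f ∷ fs) = cong (proj₁ f ∷_) (lblT-ωFields fs)

⊢recd-ωFields : ∀ {Γ} fs {gs} → (∀ {f} → f ∈ gs → f ∈ fs) → Γ ⊢ recd fs ∶ ωFields gs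
⊢recd-ωFields fs {[]}     _    = ⊢⟨⟩
⊢recd-ωFields fs {_ ∷ gs} gs⊆fs =
  ⊢∩ (⊢rec (gs⊆fs (here refl)) ⊢ω) (⊢recd-ωFields fs (λ f∈ → gs⊆fs (there f∈)))

field+ωFields≼field : ∀ {l X} → IsType X → ∀ fs → ¬ l ∈ lblR fs
                      → ⟨ l ∶ X ⟩ +ᵣ ωFields fs ≼ ⟨ l ∶ X ⟩
field+ωFields≼field X-ty []       _   = ax→ (+⟨⟩ (rl X-ty))
field+ωFields≼field X-ty (_ ∷ fs) l∉ =
  ≼-trans (ax→ (diff (λ l≡ → l∉ (here l≡)) X-ty tω (ωFields-isRec fs)))
    (≼-trans (∩≼ʳ (trec (rl tω)) (trec (r+ (rl X-ty) (ωFields-isRec fs))))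
      (field+ωFields≼field X-ty fs (λ l∈ → l∉ (there l∈))))

module _ {ℒ : List Label} (m : MixinSpec ℒ) where
  open MixinSpec m

  mixin-⊢-main : [] ⊢ term ∶ (σM ⇒ ρ¹) ⇒ (σM ⇒ ρ²)
  mixin-⊢-main = ⊢sub (typed ⟨⟩ r⟨⟩)
    (⇒≼ (⇒≼ (≼-refl σM-ty) (≼∩ ρ¹≼⟨⟩ (≼-refl (trec ρ¹-rec))))
        (⇒≼ (≼-refl σM-ty) (ax→ (⟨⟩+ ρ²-rec))))
    where
    ρ¹≼⟨⟩ : ρ¹ ≼ ⟨⟩
    ρ¹≼⟨⟩ = ↝-rec≼⟨⟩ ρ¹-rec (⟦⟧⇒↝ ℒ ρ¹ ρ¹-tr)

  mixin-⊢-frame : ∀ {l X} → IsType X → ¬ l ∈ LM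
                  → [] ⊢ term ∶ (σM ⇒ ⟨ l ∶ X ⟩) ⇒ (σM ⇒ ⟨ l ∶ X ⟩)
  mixin-⊢-frame {l} {X} X-ty l∉LM =
    ⊢lam T-ty (⊢app (⊢Y T-ty) (⊢lam tω (⊢lam σM-ty
      (⊢sub (⊢⊕ (rl X-ty) (ωFields-isRec RM) (⊢app (⊢var argClass-bound) (⊢var state-bound))
                (⊢recd-ωFields RM (λ f∈ → f∈)) RM-labels)
            (field+ωFields≼field X-ty RM l∉LM)))))
    where
    T : Ty
    T = σM ⇒ ⟨ l ∶ X ⟩

    T-ty : IsType T
    T-ty = t⇒ σM-ty (trec (rl X-ty))

    Γ : Basis
    Γ = (state , σM) ∷ (myClass , ω) ∷ (argClass , T) ∷ []

    argClass-bound : lookupB argClass Γ ≡ just T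
    argClass-bound =
      trans (lookupB-there σM _ arg≢state)
        (trans (lookupB-there ω _ arg≢my) (lookupB-here argClass T []))

    state-bound : lookupB state Γ ≡ just σM
    state-bound = lookupB-here state σM _

    RM-labels : lblR RM ≈ˡ lblT (ωFields RM)
    RM-labels l′ rewrite lblT-ωFields RM = mk⇔ (λ l∈ → l∈) (λ l∈ → l∈)

  mixin-⊢-decode : ∀ S → [] ⊢ term ∶ decode (applyS S (mixinType m))
  mixin-⊢-decode S =
    ⊢∩ main (⊢-decode-⋂ S (map⁺ (All.map frame (all-filter (λ l → ¬? (l ∈? LM)) ℒ))))
    where
    σM≡ : decode (applyS S ⟦σM⟧) ≡ σM
    σM≡ = ↝-decode-applyS S (⟦⟧⇒↝ ℒ σM σM-tr)

    main : [] ⊢ term ∶ decode (applyS S ((⟦σM⟧ ⇒C ⟦ρ¹⟧) ⇒C (⟦σM⟧ ⇒C ⟦ρ²⟧)))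
    main rewrite σM≡ | ↝-decode-applyS S (⟦⟧⇒↝ ℒ ρ¹ ρ¹-tr)
               | ↝-decode-applyS S (⟦⟧⇒↝ ℒ ρ² ρ²-tr) = mixin-⊢-main

    frame : ∀ {l} → ¬ l ∈ LM
            → [] ⊢ term ∶ decode (applyS S ((⟦σM⟧ ⇒C recVar l) ⇒C (⟦σM⟧ ⇒C recVar l)))
    frame {l} l∉LM rewrite σM≡ = mixin-⊢-frame (decode-isType (S l)) l∉LM

class-⊢-decode : ∀ {ℒ} (c : ClassSpec ℒ) S → [] ⊢ ClassSpec.term c ∶ decode (applyS S (ClassSpec.τC c))
class-⊢-decode {ℒ} c S =
  subst ([] ⊢ term ∶_) (sym (↝-decode-applyS S (⟦⟧⇒↝ ℒ (σC ⇒ ρC) ⟦σ→ρ⟧))) typed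
  where open ClassSpec c

DecodesSoundly : Repo Term → Set
DecodesSoundly Δ = ∀ {c τ} → (c , τ) ∈ Δ → ∀ S → [] ⊢ c ∶ decode (applyS S τ)

Δrepo-decodesSoundly : ∀ ℒ 𝒞 ℳ → DecodesSoundly (Δrepo ℒ 𝒞 ℳ)
Δrepo-decodesSoundly ℒ 𝒞 ℳ {c} {τ} entry S = fromEntry (∈-++⁻ (map classEntry 𝒞) entry)
  where
  classEntry : ClassSpec ℒ → Term × TyC
  classEntry C = ClassSpec.term C , ClassSpec.τC C

  mixinEntry : MixinSpec ℒ → Term × TyC
  mixinEntry M = MixinSpec.term M , mixinType M

  fromEntry : (c , τ) ∈ map classEntry 𝒞 ⊎ (c , τ) ∈ map mixinEntry ℳ
              → [] ⊢ c ∶ decode (applyS S τ)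
  fromEntry (inj₁ e) with C , _ , refl ← ∈-map⁻ classEntry e = class-⊢-decode C S
  fromEntry (inj₂ e) with M , _ , refl ← ∈-map⁻ mixinEntry e = mixin-⊢-decode M S

decode-sound : ∀ {Δ k E τ} → DecodesSoundly Δ → Δ ⊢[ k ] E ∶ τ → [] ⊢ toΛ E ∶ decode τ
decode-sound Δ-sound (⊢ax S entry _) = Δ-sound entry S
decode-sound Δ-sound (⊢app d e)      = ⊢app (decode-sound Δ-sound d) (decode-sound Δ-sound e)
decode-sound Δ-sound (⊢∩ d e)        = ⊢∩ (decode-sound Δ-sound d) (decode-sound Δ-sound e)
decode-sound Δ-sound (⊢sub d τ≼τ′)   = ⊢sub (decode-sound Δ-sound d) (decode-mono τ≼τ′)

theorem5p4 : (ℒ : List Label) (𝒞 : List (ClassSpec ℒ)) (ℳ : List (MixinSpec ℒ))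
    → Unique (map ClassSpec.term 𝒞) → Unique (map MixinSpec.term ℳ)
    → (Ms : List (MixinSpec ℒ)) → All (_∈ ℳ) Ms
    → (C : ClassSpec ℒ) → C ∈ 𝒞
    → (σ ρ : Ty) → IsType σ → IsRec ρ
    → (τ : TyC) → ⟦ σ ⇒ ρ ⟧ ℒ ≡ just τ
    → (k : ℕ)
    → Δrepo ℒ 𝒞 ℳ ⊢[ k ] pipe (name (ClassSpec.term C)) (map (λ M → name (MixinSpec.term M)) Ms) ∶ τ
    → [] ⊢ toΛ (pipe (name (ClassSpec.term C)) (map (λ M → name (MixinSpec.term M)) Ms)) ∶ σ ⇒ ρ
theorem5p4 ℒ 𝒞 ℳ _ _ Ms _ C _ σ ρ _ _ τ τ≡⟦σ⇒ρ⟧ k d =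
  subst ([] ⊢ _ ∶_) (↝-decode (⟦⟧⇒↝ ℒ (σ ⇒ ρ) τ≡⟦σ⇒ρ⟧))
    (decode-sound (Δrepo-decodesSoundly ℒ 𝒞 ℳ) d)
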